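{- For every integer $n \geq 3$, the square of the path $P_n^2$ admits a signed product cordial labeling.
   Context: All graphs are finite, simple and undirected. A vertex labeling $\alpha: V(G) \to \{1,-1\}$ induces the edge labeling $\alpha^*: E(G) \to \{1,-1\}$ given by $\alpha^*(uv) = \alpha(u)\alpha(v)$. For $a \in \{1,-1\}$, let $v_\alpha(a)$ be the number of vertices labeled $a$ and $e_{\alpha^*}(a)$ the number of edges labeled $a$. The labeling $\alpha$ is a signed product cordial labeling if $|v_\alpha(-1) - v_\alpha(1)| \leq 1$ and $|e_{\alpha^*}(-1) - e_{\alpha^*}(1)| \leq 1$. $P_n$ is the path on vertices $v_1, \dots, v_n$ with edges $v_iv_{i+1}$, $1 \le i \le n-1$. The square $P_n^2$ is obtained from $P_n$ by additionally joining every two vertices at distance $2$ in $P_n$, i.e. adding the edges $v_iv_{i+2}$, $1 \le i \le n-2$; it has $n$ vertices and $2n-3$ edges. -}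

module Defs where

open import Data.Nat using (ℕ; suc; _+_; _≤_; _<_; _≟_; _<?_)
open import Data.Integer using (ℤ; _-_; ∣_∣; +_)
open import Data.Fin using (Fin; toℕ)
open import Data.Sign using (Sign) renaming (_*_ to _⊗_)
import Data.Sign as Sign
open import Data.List using (List; length; filter; allFin; cartesianProduct)
open import Data.Product using (_×_; _,_; proj₁; proj₂)
open import Data.Sum using (_⊎_)
open import Relation.Nullary using (Dec)
open import Relation.Nullary.Decidable using (_×-dec_; _⊎-dec_)
open import Relation.Binary.PropositionalEquality using (_≡_)

-- Labels 1 and -1 are represented by Sign.+ and Sign.- ; the product of
-- labels is sign multiplication.

-- The square of the path P_n on vertices Fin n (vertex v_{i+1} is index i):
-- i and j are adjacent iff they are at distance 1 or 2 in P_n.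
IsEdgeP² : {n : ℕ} → Fin n → Fin n → Set
IsEdgeP² i j = (toℕ j ≡ suc (toℕ i)) ⊎ (toℕ j ≡ suc (suc (toℕ i)))

isEdgeP²? : {n : ℕ} → (i j : Fin n) → Dec (IsEdgeP² i j)
isEdgeP²? i j = (toℕ j ≟ suc (toℕ i)) ⊎-dec (toℕ j ≟ suc (suc (toℕ i)))

edgesP² : (n : ℕ) → List (Fin n × Fin n)
edgesP² n = filter (λ e → isEdgeP²? (proj₁ e) (proj₂ e))
                   (cartesianProduct (allFin n) (allFin n))

vcount : {n : ℕ} → (Fin n → Sign) → Sign → ℕ
vcount {n} α a = length (filter (λ v → α v Sign.≟ a) (allFin n))

ecount : (n : ℕ) → (Fin n → Sign) → Sign → ℕ
ecount n α a = length (filter (λ e → (α (proj₁ e) ⊗ α (proj₂ e)) Sign.≟ a) (edgesP² n))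

absDiff : ℕ → ℕ → ℕ
absDiff x y = ∣ + x - + y ∣

IsSignedProductCordialP² : (n : ℕ) → (Fin n → Sign) → Set
IsSignedProductCordialP² n α =
  (absDiff (vcount α Sign.-) (vcount α Sign.+) ≤ 1) ×
  (absDiff (ecount n α Sign.-) (ecount n α Sign.+) ≤ 1)

{-# OPTIONS --safe #-}
module Submission where

-- Label the vertices alternately +, -, +, - along the path, i.e. v_i gets (-1)^(i-1).
-- The two label classes then have sizes ⌈n/2⌉ and ⌊n/2⌋, and an edge v_i v_j gets
-- (-1)^(j-i): the n - 1 path edges are labelled -1 and the n - 2 edges joining
-- vertices at distance 2 are labelled +1.

open import Defs
open import Function using (_∘_; id)
open import Data.Bool using (true; false)
open import Data.Nat using (ℕ; zero; suc; _+_; _∸_; _⊓_; _≤_; _<_; z≤n; s≤s; ⌊_/2⌋; ⌈_/2⌉; _≟_)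
open import Data.Nat.Properties
open import Data.Nat.ListAction using (sum)
open import Data.Fin using (Fin; toℕ)
import Data.Fin as Fin
open import Data.Fin.Properties using (toℕ<n)
open import Data.Sign using (Sign; opposite) renaming (_*_ to _⊗_)
import Data.Sign as Sign
open import Data.Sign.Properties using (s*s≡+; opposite-involutive)
open import Data.List using (List; []; _∷_; _++_; map; length; filter; tabulate; allFin; cartesianProduct)
open import Data.List.Properties using (filter-++; length-++; map-tabulate; filter-≐; filter-none)
open import Data.List.Relation.Unary.All.Properties using (tabulate⁺)
open import Data.Product using (∃; _×_; _,_; proj₁; proj₂)
open import Data.Sum using (inj₁; inj₂)
open import Data.Integer using (∣_∣; _⊖_)
open import Data.Integer.Properties using (m-n≡m⊖n; ∣⊖∣-≤; ∣m⊖n∣≡∣n⊖m∣)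
open import Level using (Level; 0ℓ)
open import Relation.Nullary using (does; yes; no; contradiction)
open import Relation.Unary using (Pred; Decidable; _≐_; _∩_)
open import Relation.Unary.Properties using (_∩?_)
open import Relation.Binary.PropositionalEquality

private
  variable
    a b p q : Level
    A : Set a
    B : Set b

length-filter-map : {P : Pred B p} (P? : Decidable P) (f : A → B) (xs : List A) →
                    length (filter P? (map f xs)) ≡ length (filter (P? ∘ f) xs)
length-filter-map P? f [] = refl
length-filter-map P? f (x ∷ xs) with does (P? (f x))
... | true  = cong suc (length-filter-map P? f xs)
... | false = length-filter-map P? f xs

filter-filter : {P : Pred A p} {Q : Pred A q} (P? : Decidable P) (Q? : Decidable Q) (xs : List A) →
                filter Q? (filter P? xs) ≡ filter (P? ∩? Q?) xs
filter-filter P? Q? [] = refl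
filter-filter P? Q? (x ∷ xs) with P? x
... | no  _ = filter-filter P? Q? xs
... | yes _ with Q? x
...   | yes _ = cong (x ∷_) (filter-filter P? Q? xs)
...   | no  _ = filter-filter P? Q? xs

length-filter-cartesianProduct : {P : Pred (A × B) p} (P? : Decidable P) (xs : List A) (ys : List B) →
  length (filter P? (cartesianProduct xs ys)) ≡ sum (map (λ x → length (filter (λ y → P? (x , y)) ys)) xs)
length-filter-cartesianProduct P? [] ys = refl
length-filter-cartesianProduct P? (x ∷ xs) ys = begin
  length (filter P? (map (x ,_) ys ++ cartesianProduct xs ys))
    ≡⟨ cong length (filter-++ P? (map (x ,_) ys) (cartesianProduct xs ys)) ⟩
  length (filter P? (map (x ,_) ys) ++ filter P? (cartesianProduct xs ys))
    ≡⟨ length-++ (filter P? (map (x ,_) ys)) ⟩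
  length (filter P? (map (x ,_) ys)) + length (filter P? (cartesianProduct xs ys))
    ≡⟨ cong₂ _+_ (length-filter-map P? (x ,_) ys) (length-filter-cartesianProduct P? xs ys) ⟩
  length (filter (λ y → P? (x , y)) ys) + sum (map (λ x → length (filter (λ y → P? (x , y)) ys)) xs)
    ∎
  where open ≡-Reasoning

length-filter-tabulate : ∀ {n} {P : Pred A p} (P? : Decidable P) (f : Fin n → A) →
  length (filter P? (tabulate f)) ≡ length (filter (P? ∘ f) (allFin n))
length-filter-tabulate {n = n} P? f =
  trans (cong (length ∘ filter P?) (sym (map-tabulate id f))) (length-filter-map P? f (allFin n))

count-toℕ≡-< : ∀ {n m} → m < n → length (filter (λ j → toℕ j ≟ m) (allFin n)) ≡ 1
count-toℕ≡-< {suc n} {zero} _ = begin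
  suc (length (filter (λ j → toℕ j ≟ 0) (tabulate {n = n} Fin.suc)))
    ≡⟨ cong suc (length-filter-tabulate {n = n} (λ j → toℕ j ≟ 0) Fin.suc) ⟩
  suc (length (filter (λ j → suc (toℕ j) ≟ 0) (allFin n)))
    ≡⟨ cong (suc ∘ length) (filter-none (λ j → suc (toℕ j) ≟ 0) {allFin n} (tabulate⁺ (λ _ ()))) ⟩
  1 ∎
  where open ≡-Reasoning
count-toℕ≡-< {suc n} {suc m} (s≤s m<n) = begin
  length (filter (λ j → toℕ j ≟ suc m) (tabulate {n = n} Fin.suc))
    ≡⟨ length-filter-tabulate {n = n} (λ j → toℕ j ≟ suc m) Fin.suc ⟩
  length (filter (λ j → suc (toℕ j) ≟ suc m) (allFin n))
    ≡⟨ cong length (filter-≐ (λ j → suc (toℕ j) ≟ suc m) (λ j → toℕ j ≟ m)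
                             (suc-injective , cong suc) (allFin n)) ⟩
  length (filter (λ j → toℕ j ≟ m) (allFin n))
    ≡⟨ count-toℕ≡-< m<n ⟩
  1 ∎
  where open ≡-Reasoning

count-toℕ≡-≥ : ∀ {n m} → n ≤ m → length (filter (λ j → toℕ j ≟ m) (allFin n)) ≡ 0
count-toℕ≡-≥ n≤m = cong length (filter-none (λ j → toℕ j ≟ _)
  (tabulate⁺ λ j j≡m → <⇒≱ (toℕ<n j) (subst (_ ≤_) (sym j≡m) n≤m)))

sum-tabulate-indicator : ∀ {n} k (f : Fin n → ℕ) →
  (∀ i → toℕ i < k → f i ≡ 1) → (∀ i → k ≤ toℕ i → f i ≡ 0) → sum (tabulate f) ≡ k ⊓ n
sum-tabulate-indicator {zero}  k       f _     _     = sym (⊓-zeroʳ k)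
sum-tabulate-indicator {suc n} zero    f _     above =
  cong₂ _+_ (above Fin.zero z≤n)
    (sum-tabulate-indicator zero (f ∘ Fin.suc) (λ _ ()) (λ i _ → above (Fin.suc i) z≤n))
sum-tabulate-indicator {suc n} (suc k) f below above =
  cong₂ _+_ (below Fin.zero (s≤s z≤n))
    (sum-tabulate-indicator k (f ∘ Fin.suc) (λ i i<k → below (Fin.suc i) (s≤s i<k))
                                            (λ i k≤i → above (Fin.suc i) (s≤s k≤i)))

module _ {n : ℕ} where

  Edge : Pred (Fin n × Fin n) 0ℓ
  Edge e = IsEdgeP² (proj₁ e) (proj₂ e)

  EdgeLabel : (Fin n → Sign) → Sign → Pred (Fin n × Fin n) 0ℓ
  EdgeLabel α s e = α (proj₁ e) ⊗ α (proj₂ e) ≡ s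

  AtDistance : ℕ → Pred (Fin n × Fin n) 0ℓ
  AtDistance d e = toℕ (proj₂ e) ≡ d + toℕ (proj₁ e)

  atDistance? : ∀ d → Decidable (AtDistance d)
  atDistance? d e = toℕ (proj₂ e) ≟ d + toℕ (proj₁ e)

count-pairs-at-distance : ∀ n d → length (filter (atDistance? d) (cartesianProduct (allFin n) (allFin n))) ≡ n ∸ d
count-pairs-at-distance n d = begin
  length (filter (atDistance? d) (cartesianProduct (allFin n) (allFin n)))
    ≡⟨ length-filter-cartesianProduct (atDistance? d) (allFin n) (allFin n) ⟩
  sum (map row (allFin n))
    ≡⟨ cong sum (map-tabulate id row) ⟩
  sum (tabulate row)
    ≡⟨ sum-tabulate-indicator (n ∸ d) row (λ i → count-toℕ≡-< ∘ below) (λ i → count-toℕ≡-≥ ∘ above) ⟩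
  (n ∸ d) ⊓ n
    ≡⟨ m≤n⇒m⊓n≡m (m∸n≤m n d) ⟩
  n ∸ d ∎
  where
  open ≡-Reasoning
  -- row i holds the single pair (i , d + i) when d + i < n, and nothing otherwise
  row : Fin n → ℕ
  row i = length (filter (λ j → toℕ j ≟ d + toℕ i) (allFin n))
  above : ∀ {k} → n ∸ d ≤ k → n ≤ d + k
  above n∸d≤k = ≤-trans (m≤n+m∸n n d) (+-monoʳ-≤ d n∸d≤k)
  below : ∀ {k} → k < n ∸ d → d + k < n
  below k<n∸d = ≰⇒> (λ n≤d+k → <⇒≱ k<n∸d (m≤n+o⇒m∸n≤o n d n≤d+k))

alternating : ℕ → Sign
alternating zero    = Sign.+
alternating (suc k) = opposite (alternating k)

s*opposite[t]≡opposite[s*t] : ∀ s t → s ⊗ opposite t ≡ opposite (s ⊗ t)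
s*opposite[t]≡opposite[s*t] Sign.+ t = refl
s*opposite[t]≡opposite[s*t] Sign.- t = refl

alternating[k]*alternating[d+k]≡alternating[d] : ∀ d k → alternating k ⊗ alternating (d + k) ≡ alternating d
alternating[k]*alternating[d+k]≡alternating[d] zero    k = s*s≡+ (alternating k)
alternating[k]*alternating[d+k]≡alternating[d] (suc d) k =
  trans (s*opposite[t]≡opposite[s*t] (alternating k) (alternating (d + k)))
        (cong opposite (alternating[k]*alternating[d+k]≡alternating[d] d k))

alternatingLabel : ∀ {n} → Fin n → Sign
alternatingLabel i = alternating (toℕ i)

module _ {n : ℕ} where

  ecount≡n∸d : ∀ (α : Fin n → Sign) s d → (Edge ∩ EdgeLabel α s) ≐ AtDistance d → ecount n α s ≡ n ∸ d
  ecount≡n∸d α s d edges≐ = begin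
    ecount n α s
      ≡⟨ cong length (filter-filter isEdge? label? pairs) ⟩
    length (filter (isEdge? ∩? label?) pairs)
      ≡⟨ cong length (filter-≐ (isEdge? ∩? label?) (atDistance? d) edges≐ pairs) ⟩
    length (filter (atDistance? d) pairs)
      ≡⟨ count-pairs-at-distance n d ⟩
    n ∸ d ∎
    where
    open ≡-Reasoning
    pairs : List (Fin n × Fin n)
    pairs = cartesianProduct (allFin n) (allFin n)
    isEdge? : Decidable Edge
    isEdge? e = isEdgeP²? (proj₁ e) (proj₂ e)
    label? : Decidable (EdgeLabel α s)
    label? e = α (proj₁ e) ⊗ α (proj₂ e) Sign.≟ s

  alternating-edgeLabel : ∀ {d} (e : Fin n × Fin n) →
                          AtDistance d e → EdgeLabel alternatingLabel (alternating d) e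
  alternating-edgeLabel {d} (i , j) j≡d+i =
    trans (cong (λ k → alternating (toℕ i) ⊗ alternating k) j≡d+i)
          (alternating[k]*alternating[d+k]≡alternating[d] d (toℕ i))

  negative-edges : (Edge ∩ EdgeLabel alternatingLabel Sign.-) ≐ AtDistance 1
  negative-edges = (λ {e} → to e) , λ {e} j≡1+i → inj₁ j≡1+i , alternating-edgeLabel e j≡1+i
    where
    to : ∀ e → (Edge ∩ EdgeLabel alternatingLabel Sign.-) e → AtDistance 1 e
    to e (inj₁ j≡1+i , _)  = j≡1+i
    to e (inj₂ j≡2+i , -≡) = contradiction (trans (sym (alternating-edgeLabel e j≡2+i)) -≡) λ ()

  positive-edges : (Edge ∩ EdgeLabel alternatingLabel Sign.+) ≐ AtDistance 2
  positive-edges = (λ {e} → to e) , λ {e} j≡2+i → inj₂ j≡2+i , alternating-edgeLabel e j≡2+i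
    where
    to : ∀ e → (Edge ∩ EdgeLabel alternatingLabel Sign.+) e → AtDistance 2 e
    to e (inj₁ j≡1+i , +≡) = contradiction (trans (sym (alternating-edgeLabel e j≡1+i)) +≡) λ ()
    to e (inj₂ j≡2+i , _)  = j≡2+i

vcount-alternating-2+ : ∀ n s → vcount (alternatingLabel {2 + n}) s ≡ suc (vcount (alternatingLabel {n}) s)
vcount-alternating-2+ n s = trans (first-two s) (cong suc (begin
  length (filter (λ v → alternatingLabel v Sign.≟ s) (tabulate {n = n} (Fin.suc ∘ Fin.suc)))
    ≡⟨ length-filter-tabulate {n = n} (λ v → alternatingLabel v Sign.≟ s) (Fin.suc ∘ Fin.suc) ⟩
  length (filter (λ v → opposite (opposite (alternatingLabel v)) Sign.≟ s) (allFin n))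
    ≡⟨ cong length (filter-≐ (λ v → opposite (opposite (alternatingLabel v)) Sign.≟ s)
                             (λ v → alternatingLabel v Sign.≟ s)
                             (trans (sym (opposite-involutive _)) , trans (opposite-involutive _))
                             (allFin n)) ⟩
  vcount (alternatingLabel {n}) s ∎))
  where
  open ≡-Reasoning
  first-two : ∀ s → vcount (alternatingLabel {2 + n}) s ≡
    suc (length (filter (λ v → alternatingLabel v Sign.≟ s) (tabulate {n = n} (Fin.suc ∘ Fin.suc))))
  first-two Sign.+ = refl
  first-two Sign.- = refl

vcount-alternating-minus : ∀ n → vcount (alternatingLabel {n}) Sign.- ≡ ⌊ n /2⌋
vcount-alternating-minus 0             = refl
vcount-alternating-minus 1             = refl
vcount-alternating-minus (suc (suc n)) =
  trans (vcount-alternating-2+ n Sign.-) (cong suc (vcount-alternating-minus n))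

vcount-alternating-plus : ∀ n → vcount (alternatingLabel {n}) Sign.+ ≡ ⌈ n /2⌉
vcount-alternating-plus 0             = refl
vcount-alternating-plus 1             = refl
vcount-alternating-plus (suc (suc n)) =
  trans (vcount-alternating-2+ n Sign.+) (cong suc (vcount-alternating-plus n))

absDiff≡∣⊖∣ : ∀ x y → absDiff x y ≡ ∣ x ⊖ y ∣
absDiff≡∣⊖∣ x y = cong ∣_∣ (m-n≡m⊖n x y)

absDiff-comm : ∀ x y → absDiff x y ≡ absDiff y x
absDiff-comm x y = trans (absDiff≡∣⊖∣ x y) (trans (∣m⊖n∣≡∣n⊖m∣ x y) (sym (absDiff≡∣⊖∣ y x)))

absDiff≤1 : ∀ {x y} → x ≤ y → y ≤ suc x → absDiff x y ≤ 1
absDiff≤1 {x} {y} x≤y y≤1+x = begin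
  absDiff x y ≡⟨ absDiff≡∣⊖∣ x y ⟩
  ∣ x ⊖ y ∣   ≡⟨ ∣⊖∣-≤ x≤y ⟩
  y ∸ x       ≤⟨ m≤n+o⇒m∸n≤o y x (subst (y ≤_) (+-comm 1 x) y≤1+x) ⟩
  1           ∎
  where open ≤-Reasoning

⌈n/2⌉≤1+⌊n/2⌋ : ∀ n → ⌈ n /2⌉ ≤ suc ⌊ n /2⌋
⌈n/2⌉≤1+⌊n/2⌋ n = ⌊n/2⌋-mono (n≤1+n (suc n))

absDiff[n∸1,n∸2]≤1 : ∀ n → absDiff (n ∸ 1) (n ∸ 2) ≤ 1
absDiff[n∸1,n∸2]≤1 0             = z≤n
absDiff[n∸1,n∸2]≤1 1             = z≤n
absDiff[n∸1,n∸2]≤1 (suc (suc m)) = subst (_≤ 1) (absDiff-comm m (suc m)) (absDiff≤1 (n≤1+n m) ≤-refl)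

alternatingLabel-isSignedProductCordial : ∀ n → IsSignedProductCordialP² n alternatingLabel
alternatingLabel-isSignedProductCordial n =
  subst₂ (λ x y → absDiff x y ≤ 1) (sym (vcount-alternating-minus n)) (sym (vcount-alternating-plus n))
    (absDiff≤1 (⌊n/2⌋≤⌈n/2⌉ n) (⌈n/2⌉≤1+⌊n/2⌋ n)) ,
  subst₂ (λ x y → absDiff x y ≤ 1)
    (sym (ecount≡n∸d {n} alternatingLabel Sign.- 1 negative-edges))
    (sym (ecount≡n∸d {n} alternatingLabel Sign.+ 2 positive-edges))
    (absDiff[n∸1,n∸2]≤1 n)

theorem2p3 : (n : ℕ) → 3 ≤ n → ∃ λ (α : Fin n → Sign) → IsSignedProductCordialP² n α
theorem2p3 n _ = alternatingLabel , alternatingLabel-isSignedProductCordial n
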